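{- Let $n>1$ be an integer and consider the mixed graph $G^+(n)$. Then: (i) the vertices $0|00\ldots0$ and $0|11\ldots1$ have eccentricity $2n$, which is the maximum eccentricity of a vertex of $G^+(n)$; (ii) the vertices $1|00\ldots0$ and $1|11\ldots1$ have eccentricity $2n-1$; (iii) if $n\ge 5$, the vertices $1|00\ldots01$ and $1|11\ldots10$ have eccentricity $2n-2$.
   Context: A mixed graph has a vertex set, a set of (undirected) edges and a set of arcs; loops and pairs of opposite arcs are allowed. A walk may traverse an edge in either direction and an arc only from tail to head; $\mathrm{dist}(u,v)$ is the length of a shortest walk from $u$ to $v$, and the eccentricity of $u$ is $\max_v \mathrm{dist}(u,v)$. For $n\ge 2$, $G^+(n)$ has as vertices all $2^{n+1}$ labels $x_0|x_1\ldots x_n$ with $x_i\in\mathbb{Z}_2$; its edges join $x_0|x_1\ldots x_n$ and $(x_0+1)|x_1\ldots x_n$, and its arcs go from $x_0|x_1x_2\ldots x_n$ to $x_0|x_2\ldots x_n(x_1+x_0)$, arithmetic modulo 2. -}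

module Defs where

open import Data.Bool using (Bool; true; false; not; _xor_)
open import Data.Nat using (ℕ; zero; suc; _≤_)
open import Data.Vec using (Vec; []; _∷_; _∷ʳ_; replicate)
open import Data.Product using (_×_; ∃; ∃-syntax; _,_)

-- Vertices of G⁺(n): labels x₀|x₁…xₙ, with Bool as ℤ₂ (xor = addition mod 2).
V : ℕ → Set
V n = Bool × Vec Bool n

shiftArc : ∀ {n} → Bool → Vec Bool n → Vec Bool n
shiftArc x₀ []       = []
shiftArc x₀ (x₁ ∷ xs) = xs ∷ʳ (x₁ xor x₀)

-- One step of a walk: traverse the edge {x₀|x, (x₀+1)|x} (in either direction;
-- the edge relation is symmetric), or traverse the arc x₀|x → x₀|shiftArc x₀ x.
data Step {n : ℕ} : V n → V n → Set where
  edge : ∀ x₀ x → Step (x₀ , x) (not x₀ , x)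
  arc  : ∀ x₀ x → Step (x₀ , x) (x₀ , shiftArc x₀ x)

data Walk {n : ℕ} : V n → V n → ℕ → Set where
  here : ∀ {u} → Walk u u zero
  step : ∀ {u w v k} → Step u w → Walk w v k → Walk u v (suc k)

IsDist : ∀ {n} → V n → V n → ℕ → Set
IsDist u v d = Walk u v d × (∀ k → Walk u v k → d ≤ k)

Ecc : ∀ {n} → V n → ℕ → Set
Ecc {n} u e = (∀ (v : V n) → ∃[ d ] (IsDist u v d × d ≤ e)) × (∃[ v ] IsDist u v e)

-- Write a vertex as x₀|window z n, the first n bits of a stream z. An arc shifts the
-- window one step along z provided x₀ = z i ⊕ z (i + n) at the current position i, so
-- every walk can be rearranged, without getting longer, into a canonical one: it
-- follows a stream z for k arcs and toggles x₀ only right before an arc or at the end.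
-- Its length is k plus the number of changes in the sequence a, B 0, …, B (k - 1), c
-- of values of x₀, where B i = z i ⊕ z (i + n).
--
-- Upper bounds come from good streams: x followed by y, possibly sharing some bits or
-- with one extra bit in between that breaks an alternating sequence B. Lower bounds come
-- from the target 0|1010…: if x starts with q zeros, the stream of any walk from x₀|x to
-- it must give alternating B on most of the last q arcs. Complementing x₁…xₙ is an
-- automorphism of G⁺(n), which transfers the results to the complemented vertices.
module Submission where

open import Algebra.Properties.CommutativeSemigroup using (x∙yz≈y∙xz)
open import Data.Bool using (Bool; true; false; not; _xor_)
open import Data.Bool.Properties
  using (_≟_; not-involutive; not-distribˡ-xor; not-¬; ¬-not; xor-assoc; xor-same; xor-identityʳ; xor-inverseʳ)
open import Data.Nat using (ℕ; zero; suc; _+_; _*_; _∸_; _≤_; _<_; _≤?_; z≤n; s≤s)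
open import Data.Nat.Properties hiding (_≟_)
open import Data.Nat.Tactic.RingSolver using (solve-∀)
open import Data.Product using (_×_; _,_; proj₁; proj₂; ∃-syntax)
import Data.Product.Properties as Product
open import Data.Sum using (_⊎_; inj₁; inj₂)
open import Data.Vec using (Vec; []; _∷_; _∷ʳ_; replicate; map)
open import Data.Vec.Properties as Vec
  using (∷-injective; ∷ʳ-injective; map-∘; map-cong; map-id; map-∷ʳ; map-replicate)
open import Function using (_∘_)
open import Relation.Binary.Definitions using (tri<; tri≈; tri>)
open import Relation.Binary.PropositionalEquality
open import Relation.Nullary using (Dec; yes; no; ¬_; contradiction)

open import Defs

xor-cancelˡ : ∀ a b → a xor (a xor b) ≡ b
xor-cancelˡ a b = trans (sym (xor-assoc a a b)) (cong (_xor b) (xor-same a))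

not-xor-cancelˡ : ∀ a b → not a xor (a xor b) ≡ not b
not-xor-cancelˡ a b = trans (sym (not-distribˡ-xor a (a xor b))) (cong not (xor-cancelˡ a b))

2*suc∸1 : ∀ k → 2 * suc k ∸ 1 ≡ suc (k + k)
2*suc∸1 k = trans (+-suc k (k + 0)) (cong (suc ∘ (k +_)) (+-identityʳ k))

2*suc∸2 : ∀ k → 2 * suc k ∸ 2 ≡ k + k
2*suc∸2 k = cong (_∸ 1) (2*suc∸1 k)

double : ∀ n → 2 * n ≡ n + n
double n = cong (n +_) (+-identityʳ n)

toggles : Bool → Bool → ℕ
toggles false false = 0
toggles false true  = 1
toggles true  false = 1
toggles true  true  = 0

toggles-refl : ∀ a → toggles a a ≡ 0
toggles-refl false = refl
toggles-refl true  = refl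

toggles-not : ∀ a → toggles a (not a) ≡ 1
toggles-not false = refl
toggles-not true  = refl

toggles≤1 : ∀ a b → toggles a b ≤ 1
toggles≤1 false false = z≤n
toggles≤1 false true  = ≤-refl
toggles≤1 true  false = ≤-refl
toggles≤1 true  true  = z≤n

toggles-triangle : ∀ a b c → toggles a c ≤ toggles a b + toggles b c
toggles-triangle false false c     = ≤-refl
toggles-triangle true  true  c     = ≤-refl
toggles-triangle false true  false = z≤n
toggles-triangle false true  true  = ≤-refl
toggles-triangle true  false false = ≤-refl
toggles-triangle true  false true  = z≤n

alternating : Bool → ℕ → Bool
alternating β zero    = β
alternating β (suc i) = alternating (not β) i

alternating-suc : ∀ β i → alternating β (suc i) ≡ not (alternating β i)
alternating-suc β zero    = refl
alternating-suc β (suc i) = alternating-suc (not β) i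

alternating-+ : ∀ β i j → alternating β (i + j) ≡ alternating (alternating β i) j
alternating-+ β zero    j = refl
alternating-+ β (suc i) j = alternating-+ (not β) i j

not-alternating-suc : ∀ β i → not (alternating β (suc i)) ≡ alternating β i
not-alternating-suc β i = trans (cong not (alternating-suc β i)) (not-involutive _)

alternating-suc-suc : ∀ β i → alternating β (suc (suc i)) ≡ alternating β i
alternating-suc-suc β i = trans (alternating-suc β (suc i)) (not-alternating-suc β i)

-- cost k B a c is the length of the walk that starts with x₀ = a, crosses k arcs,
-- the i-th of them with x₀ = B i, and ends with x₀ = c, toggling x₀ only when needed.
cost : ℕ → (ℕ → Bool) → Bool → Bool → ℕ
cost zero    B a c = toggles a c
cost (suc k) B a c = toggles a (B 0) + suc (cost k (B ∘ suc) (B 0) c)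

cost-head : ∀ k B a c {b} → B 0 ≡ b → cost (suc k) B a c ≡ toggles a b + suc (cost k (B ∘ suc) b c)
cost-head k B a c refl = refl

cost-cong : ∀ k {B B′} a c → (∀ i → i < k → B i ≡ B′ i) → cost k B a c ≡ cost k B′ a c
cost-cong zero    a c eq = refl
cost-cong (suc k) a c eq rewrite eq 0 (s≤s z≤n) =
  cong (λ t → _ + suc t) (cost-cong k _ c (λ i i<k → eq (suc i) (s≤s i<k)))

k≤cost : ∀ k B a c → k ≤ cost k B a c
k≤cost zero    B a c = z≤n
k≤cost (suc k) B a c = ≤-trans (s≤s (k≤cost k (B ∘ suc) (B 0) c)) (m≤n+m _ (toggles a (B 0)))

cost≤ : ∀ k B a c → cost k B a c ≤ suc (k + k)
cost≤ zero    B a c = toggles≤1 a c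
cost≤ (suc k) B a c = begin
  toggles a (B 0) + suc (cost k (B ∘ suc) (B 0) c)
    ≤⟨ +-mono-≤ (toggles≤1 a (B 0)) (s≤s (cost≤ k _ _ c)) ⟩
  suc (suc (suc (k + k)))                            ≡⟨ cong (suc ∘ suc) (sym (+-suc k k)) ⟩
  suc (suc k + suc k)                                ∎
  where open ≤-Reasoning

cost-triangle : ∀ k B a a′ c → cost k B a c ≤ toggles a a′ + cost k B a′ c
cost-triangle zero    B a a′ c = toggles-triangle a a′ c
cost-triangle (suc k) B a a′ c = begin
  toggles a (B 0) + suc R                  ≤⟨ +-monoˡ-≤ (suc R) (toggles-triangle a a′ (B 0)) ⟩
  toggles a a′ + toggles a′ (B 0) + suc R  ≡⟨ +-assoc (toggles a a′) _ _ ⟩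
  toggles a a′ + (toggles a′ (B 0) + suc R) ∎
  where open ≤-Reasoning
        R = cost k (B ∘ suc) (B 0) c

cost-split : ∀ k l B a b c → cost (k + l) B a c ≤ cost k B a b + cost l (λ i → B (k + i)) b c
cost-split zero    l B a b c = cost-triangle l B a b c
cost-split (suc k) l B a b c = begin
  toggles a (B 0) + suc (cost (k + l) (B ∘ suc) (B 0) c)
    ≤⟨ +-monoʳ-≤ (toggles a (B 0)) (s≤s (cost-split k l (B ∘ suc) (B 0) b c)) ⟩
  toggles a (B 0) + (suc (cost k (B ∘ suc) (B 0) b) + R)
    ≡⟨ sym (+-assoc (toggles a (B 0)) _ R) ⟩
  toggles a (B 0) + suc (cost k (B ∘ suc) (B 0) b) + R ∎
  where open ≤-Reasoning
        R = cost l (λ i → B (suc (k + i))) b c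

cost-drop : ∀ k l B a c → k + cost l (λ i → B (k + i)) a c ≤ cost (k + l) B a c
cost-drop zero    l B a c = ≤-refl
cost-drop (suc k) l B a c = begin
  suc (k + cost l S a c)                       ≤⟨ s≤s (+-monoʳ-≤ k (cost-triangle l S a (B 0) c)) ⟩
  suc (k + (toggles a (B 0) + cost l S (B 0) c))
    ≡⟨ cong suc (x∙yz≈y∙xz +-commutativeSemigroup k (toggles a (B 0)) _) ⟩
  suc (toggles a (B 0) + (k + cost l S (B 0) c)) ≡⟨ sym (+-suc (toggles a (B 0)) _) ⟩
  toggles a (B 0) + suc (k + cost l S (B 0) c)
    ≤⟨ +-monoʳ-≤ (toggles a (B 0)) (s≤s (cost-drop k l (B ∘ suc) (B 0) c)) ⟩
  toggles a (B 0) + suc (cost (k + l) (B ∘ suc) (B 0) c) ∎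
  where open ≤-Reasoning
        S = λ i → B (suc (k + i))

-- The maximum 2k + 1 is reached only if every arc and the final target force a toggle.
cost-dichotomy : ∀ k B a c → cost k B a c ≤ k + k
                 ⊎ ((∀ i → i < k → B i ≡ alternating (not a) i) × c ≡ alternating (not a) k)
cost-dichotomy zero B false false = inj₁ z≤n
cost-dichotomy zero B false true  = inj₂ ((λ _ ()) , refl)
cost-dichotomy zero B true  false = inj₂ ((λ _ ()) , refl)
cost-dichotomy zero B true  true  = inj₁ z≤n
cost-dichotomy (suc k) B a c with B 0 ≟ a
... | yes B₀≡a = inj₁ (begin
  cost (suc k) B a c                   ≡⟨ cost-head k B a c B₀≡a ⟩
  toggles a a + suc (cost k _ a c)     ≡⟨ cong (_+ suc (cost k (B ∘ suc) a c)) (toggles-refl a) ⟩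
  suc (cost k (B ∘ suc) a c)           ≤⟨ s≤s (cost≤ k _ a c) ⟩
  suc (suc (k + k))                    ≡⟨ cong suc (sym (+-suc k k)) ⟩
  suc k + suc k                        ∎)
  where open ≤-Reasoning
... | no B₀≢a with B₀≡¬a ← ¬-not B₀≢a
                 | cost-dichotomy k (B ∘ suc) (not a) c
...   | inj₁ ≤k+k = inj₁ (begin
  cost (suc k) B a c                        ≡⟨ cost-head k B a c B₀≡¬a ⟩
  toggles a (not a) + suc (cost k _ _ c)    ≡⟨ cong (_+ suc (cost k (B ∘ suc) (not a) c)) (toggles-not a) ⟩
  suc (suc (cost k (B ∘ suc) (not a) c))    ≤⟨ s≤s (s≤s ≤k+k) ⟩
  suc (suc (k + k))                         ≡⟨ cong suc (sym (+-suc k k)) ⟩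
  suc k + suc k                             ∎)
  where open ≤-Reasoning
...   | inj₂ (alt , c≡) = inj₂ ((λ { zero _ → B₀≡¬a ; (suc i) (s≤s i<k) → alt i i<k }) , c≡)

cost-alternating-prefix : ∀ p k B a c β → (∀ i → i ≤ p → B i ≡ alternating β i) → p < k →
                          toggles a β + (p + k) ≤ cost k B a c
cost-alternating-prefix zero (suc k) B a c β alt _
  rewrite cost-head k B a c (alt 0 z≤n) = +-monoʳ-≤ (toggles a β) (s≤s (k≤cost k _ β c))
cost-alternating-prefix (suc p) (suc k) B a c β alt (s≤s p<k)
  rewrite cost-head k B a c (alt 0 z≤n) = +-monoʳ-≤ (toggles a β) (begin
    suc p + suc k           ≡⟨ cong suc (+-suc p k) ⟩
    suc (suc (p + k))       ≡⟨ cong (λ t → suc (t + (p + k))) (sym (toggles-not β)) ⟩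
    suc (toggles β (not β) + (p + k))
      ≤⟨ s≤s (cost-alternating-prefix p k (B ∘ suc) β c (not β) (λ i → alt (suc i) ∘ s≤s) p<k) ⟩
    suc (cost k (B ∘ suc) β c) ∎)
  where open ≤-Reasoning

cost-lowerBound : ∀ r q B a c β → (∀ i → r + i < q → B (r + i) ≡ alternating β i) →
                  q + q + toggles a β ≤ suc (cost (r + q) B a c)
cost-lowerBound r q B a c β alt with q ≤? r
... | yes q≤r = begin
  q + q + toggles a β    ≤⟨ +-monoʳ-≤ (q + q) (toggles≤1 a β) ⟩
  q + q + 1              ≡⟨ +-comm (q + q) 1 ⟩
  suc (q + q)            ≤⟨ s≤s (+-monoˡ-≤ q q≤r) ⟩
  suc (r + q)            ≤⟨ s≤s (k≤cost (r + q) B a c) ⟩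
  suc (cost (r + q) B a c) ∎
  where open ≤-Reasoning
... | no q≰r with p , refl ← m≤n⇒∃[o]m+o≡n (≰⇒> q≰r) = begin
  suc r + p + (suc r + p) + toggles a β               ≡⟨ arithmetic r p (toggles a β) ⟩
  suc (r + (toggles a β + (p + (suc r + p))))
    ≤⟨ s≤s (+-monoʳ-≤ r (cost-alternating-prefix p (suc r + p) _ a c β alt′ (s≤s (m≤n+m p r)))) ⟩
  suc (r + cost (suc r + p) (λ i → B (r + i)) a c)   ≤⟨ s≤s (cost-drop r (suc r + p) B a c) ⟩
  suc (cost (r + (suc r + p)) B a c)                 ∎
  where
  open ≤-Reasoning
  arithmetic : ∀ r p t → suc r + p + (suc r + p) + t ≡ suc (r + (t + (p + (suc r + p))))
  arithmetic = solve-∀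
  alt′ : ∀ i → i ≤ p → B (r + i) ≡ alternating β i
  alt′ i i≤p = alt i (s≤s (+-monoʳ-≤ r i≤p))

cost-alternating-repeat : ∀ k β a B c → (∀ i → i ≤ k → B i ≡ alternating β i) →
                          B (suc k) ≡ alternating β k → c ≡ alternating β k →
                          cost (suc (suc k)) B a c ≡ toggles a β + suc (suc (k + k))
cost-alternating-repeat zero β a B c alt B₁≡ refl
  rewrite alt 0 z≤n | B₁≡ | toggles-refl β = refl
cost-alternating-repeat (suc k) β a B c alt B≡ c≡ rewrite cost-head (suc (suc k)) B a c (alt 0 z≤n) =
  cong (λ t → toggles a β + suc t) (begin
    cost (suc (suc k)) (B ∘ suc) β c
      ≡⟨ cost-alternating-repeat k (not β) β (B ∘ suc) c (λ i → alt (suc i) ∘ s≤s) B≡ c≡ ⟩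
    toggles β (not β) + suc (suc (k + k))   ≡⟨ cong (_+ _) (toggles-not β) ⟩
    suc (suc (suc (k + k)))                 ≡⟨ cong (suc ∘ suc) (sym (+-suc k k)) ⟩
    suc (suc k + suc k)                     ∎)
  where open ≡-Reasoning

-- Windows of streams

window : (ℕ → Bool) → (n : ℕ) → Vec Bool n
window z zero    = []
window z (suc n) = z 0 ∷ window (z ∘ suc) n

window-cong : ∀ n {z z′} → (∀ i → i < n → z i ≡ z′ i) → window z n ≡ window z′ n
window-cong zero    eq = refl
window-cong (suc n) eq = cong₂ _∷_ (eq 0 (s≤s z≤n)) (window-cong n (λ i i<n → eq (suc i) (s≤s i<n)))

window-injective : ∀ n {z z′} → window z n ≡ window z′ n → ∀ i → i < n → z i ≡ z′ i
window-injective (suc n) eq zero    _         = proj₁ (∷-injective eq)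
window-injective (suc n) eq (suc i) (s≤s i<n) = window-injective n (proj₂ (∷-injective eq)) i i<n

window-∷ʳ : ∀ n z → window z n ∷ʳ z n ≡ window z (suc n)
window-∷ʳ zero    z = refl
window-∷ʳ (suc n) z = cong (z 0 ∷_) (window-∷ʳ n (z ∘ suc))

stream : ∀ {n} → Vec Bool n → ℕ → Bool
stream []      i       = false
stream (b ∷ x) zero    = b
stream (b ∷ x) (suc i) = stream x i

window-stream : ∀ {n} (x : Vec Bool n) → window (stream x) n ≡ x
window-stream []      = refl
window-stream (b ∷ x) = cong (b ∷_) (window-stream x)

stream-replicate-false : ∀ n i → stream (replicate n false) i ≡ false
stream-replicate-false zero    i       = refl
stream-replicate-false (suc n) zero    = refl
stream-replicate-false (suc n) (suc i) = stream-replicate-false n i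

stream-∷ʳ-< : ∀ {n} (x : Vec Bool n) b i → i < n → stream (x ∷ʳ b) i ≡ stream x i
stream-∷ʳ-< (a ∷ x) b zero    _         = refl
stream-∷ʳ-< (a ∷ x) b (suc i) (s≤s i<n) = stream-∷ʳ-< x b i i<n

stream-∷ʳ-last : ∀ {n} (x : Vec Bool n) b → stream (x ∷ʳ b) n ≡ b
stream-∷ʳ-last []      b = refl
stream-∷ʳ-last (a ∷ x) b = stream-∷ʳ-last x b

stream-zeros-∷ʳ-< : ∀ m b i → i < m → stream (replicate m false ∷ʳ b) i ≡ false
stream-zeros-∷ʳ-< m b i i<m = trans (stream-∷ʳ-< (replicate m false) b i i<m) (stream-replicate-false m i)

splice : ℕ → (ℕ → Bool) → (ℕ → Bool) → ℕ → Bool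
splice zero    f g i       = g i
splice (suc k) f g zero    = f 0
splice (suc k) f g (suc i) = splice k (f ∘ suc) g i

splice-< : ∀ k f g i → i < k → splice k f g i ≡ f i
splice-< (suc k) f g zero    _         = refl
splice-< (suc k) f g (suc i) (s≤s i<k) = splice-< k (f ∘ suc) g i i<k

splice-+ : ∀ k f g i → splice k f g (k + i) ≡ g i
splice-+ zero    f g i = refl
splice-+ (suc k) f g i = splice-+ k (f ∘ suc) g i

window-splice-shift : ∀ k f g n → window (λ i → splice k f g (k + i)) n ≡ window g n
window-splice-shift k f g n = window-cong n (λ i _ → splice-+ k f g i)

-- Canonical walks

-- An arc from x₀|window z n leads to x₀|window (z ∘ suc) n when x₀ = requiredBit n z 0.
requiredBit : ℕ → (ℕ → Bool) → ℕ → Bool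
requiredBit n z i = z i xor z (i + n)

_++ʷ_ : ∀ {n} {u v w : V n} {k l} → Walk u v k → Walk v w l → Walk u w (k + l)
here     ++ʷ q = q
step s p ++ʷ q = step s (p ++ʷ q)

toggleWalk : ∀ {n} a b (x : Vec Bool n) → Walk (a , x) (b , x) (toggles a b)
toggleWalk false false x = here
toggleWalk false true  x = step (edge false x) here
toggleWalk true  false x = step (edge true x) here
toggleWalk true  true  x = here

arc-window : ∀ n z → Step (requiredBit n z 0 , window z n) (requiredBit n z 0 , window (z ∘ suc) n)
arc-window zero    z = arc _ []
arc-window (suc n) z = subst (λ y → Step (b , window z (suc n)) (b , y)) shift≡ (arc b (window z (suc n)))
  where
  b = requiredBit (suc n) z 0
  shift≡ : shiftArc b (window z (suc n)) ≡ window (z ∘ suc) (suc n)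
  shift≡ = trans (cong (window (z ∘ suc) n ∷ʳ_) (xor-cancelˡ (z 0) (z (suc n))))
                 (window-∷ʳ n (z ∘ suc))

canonicalWalk : ∀ n z k a c →
                Walk (a , window z n) (c , window (λ i → z (k + i)) n) (cost k (requiredBit n z) a c)
canonicalWalk n z zero    a c = toggleWalk a c (window z n)
canonicalWalk n z (suc k) a c =
  toggleWalk a _ (window z n) ++ʷ step (arc-window n z) (canonicalWalk n (z ∘ suc) k _ c)

ReachableWithin : ∀ {n} → V n → V n → ℕ → Set
ReachableWithin u v L = ∃[ k ] Walk u v k × k ≤ L

CanonicalWithin : ∀ {n} → V n → V n → ℕ → Set
CanonicalWithin {n} (a , x) (c , y) L =
  ∃[ z ] ∃[ k ] window z n ≡ x × window (λ i → z (k + i)) n ≡ y × cost k (requiredBit n z) a c ≤ L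

canonical⇒reachable : ∀ {n} {u v : V n} {L} → CanonicalWithin u v L → ReachableWithin u v L
canonical⇒reachable {n} {a , _} {c , _} (z , k , refl , refl , ≤L) = _ , canonicalWalk n z k a c , ≤L

walk⇒canonical : ∀ {n} {u v : V n} {L} → Walk u v L → CanonicalWithin u v L
walk⇒canonical {v = c , y} here = stream y , 0 , window-stream y , window-stream y , ≤-reflexive (toggles-refl c)
walk⇒canonical {n} {v = c , _} (step (edge a x) w) with z , k , x≡ , y≡ , ≤L ← walk⇒canonical w =
  z , k , x≡ , y≡ , (begin
    cost k (requiredBit n z) a c                             ≤⟨ cost-triangle k _ a (not a) c ⟩
    toggles a (not a) + cost k (requiredBit n z) (not a) c
      ≡⟨ cong (_+ cost k (requiredBit n z) (not a) c) (toggles-not a) ⟩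
    suc (cost k (requiredBit n z) (not a) c)                 ≤⟨ s≤s ≤L ⟩
    suc _                                                    ∎)
  where open ≤-Reasoning
walk⇒canonical (step (arc a []) w) with z , k , x≡ , y≡ , ≤L ← walk⇒canonical w =
  z , k , x≡ , y≡ , m≤n⇒m≤1+n ≤L
walk⇒canonical {suc n} {v = c , _} (step (arc a (b ∷ x)) w)
  with z , k , x≡ , y≡ , ≤L ← walk⇒canonical w
  with x≡window , z[n]≡ ← ∷ʳ-injective x (window z n) (trans (sym x≡) (sym (window-∷ʳ n z))) =
  b∷z , suc k , cong (b ∷_) (sym x≡window) , y≡ , (begin
    cost (suc k) (requiredBit (suc n) b∷z) a c   ≡⟨ cost-head k (requiredBit (suc n) b∷z) a c B₀≡a ⟩
    toggles a a + suc (cost k (requiredBit (suc n) z) a c)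
      ≡⟨ cong (_+ suc (cost k (requiredBit (suc n) z) a c)) (toggles-refl a) ⟩
    suc (cost k (requiredBit (suc n) z) a c)     ≤⟨ s≤s ≤L ⟩
    suc _                                        ∎)
  where
  open ≤-Reasoning
  b∷z : ℕ → Bool
  b∷z zero    = b
  b∷z (suc i) = z i
  B₀≡a : b xor z n ≡ a
  B₀≡a = trans (cong (b xor_) (sym z[n]≡)) (xor-cancelˡ b a)

-- The lower bound

walk-to-alternating-lowerBound :
  ∀ d q a (x : Vec Bool (d + q)) {L} → (∀ i → i < q → stream x i ≡ false) →
  Walk (a , x) (false , window (alternating true) (d + q)) L →
  q + q + toggles a (alternating true d) ≤ suc L
walk-to-alternating-lowerBound d q a x x≡0 w with z , k , x≡ , t≡ , ≤L ← walk⇒canonical w =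
  ≤-trans bound (s≤s ≤L)
  where
  n = d + q
  z≡x : ∀ i → i < n → z i ≡ stream x i
  z≡x = window-injective n (trans x≡ (sym (window-stream x)))
  z≡t : ∀ i → i < n → z (k + i) ≡ alternating true i
  z≡t = window-injective n t≡
  bound : q + q + toggles a (alternating true d) ≤ suc (cost k (requiredBit n z) a false)
  bound with q ≤? k
  ... | no q≰k = contradiction (trans (sym (trans (z≡x k k<n) (x≡0 k k<q)))
                                      (trans (cong z (sym (+-identityʳ k))) (z≡t 0 (≤-<-trans z≤n k<n))))
                               (λ ())
    where k<q = ≰⇒> q≰k
          k<n = <-≤-trans k<q (m≤n+m q d)
  ... | yes q≤k with r , refl ← m≤n⇒∃[o]m+o≡n q≤k =
    subst (λ k → q + q + toggles a (alternating true d) ≤ suc (cost k (requiredBit n z) a false)) (+-comm r q)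
      (cost-lowerBound r q (requiredBit n z) a false (alternating true d) alternates)
    where
    alternates : ∀ i → r + i < q → requiredBit n z (r + i) ≡ alternating (alternating true d) i
    alternates i r+i<q = begin
      z (r + i) xor z (r + i + (d + q))
        ≡⟨ cong₂ _xor_ (trans (z≡x (r + i) (<-≤-trans r+i<q (m≤n+m q d))) (x≡0 (r + i) r+i<q))
                       (cong z (index r i d q)) ⟩
      false xor z (q + r + (d + i))
        ≡⟨ z≡t (d + i) (+-monoʳ-< d (≤-trans (s≤s (m≤n+m i r)) r+i<q)) ⟩
      alternating true (d + i)            ≡⟨ alternating-+ true d i ⟩
      alternating (alternating true d) i  ∎
      where
      open ≡-Reasoning
      index : ∀ r i d q → r + i + (d + q) ≡ q + r + (d + i)
      index = solve-∀

-- Upper bounds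

canonical-splice : ∀ {n} k f a c (x y : Vec Bool n) {L} → window (splice k f (stream y)) n ≡ x →
                   cost k (requiredBit n (splice k f (stream y))) a c ≤ L → CanonicalWithin (a , x) (c , y) L
canonical-splice {n} k f a c x y x≡ ≤L =
  splice k f (stream y) , k , x≡ , trans (window-splice-shift k f (stream y) n) (window-stream y) , ≤L

window-splice-stream : ∀ {n} k (x y : Vec Bool n) → (∀ i → k + i < n → stream x (k + i) ≡ stream y i) →
                       window (splice k (stream x) (stream y)) n ≡ x
window-splice-stream {n} k x y shared = trans (window-cong n agree) (window-stream x)
  where
  agree : ∀ i → i < n → splice k (stream x) (stream y) i ≡ stream x i
  agree i i<n with i <? k
  ... | yes i<k = splice-< k _ _ i i<k
  ... | no i≮k with j , refl ← m≤n⇒∃[o]m+o≡n (≮⇒≥ i≮k) =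
    trans (splice-+ k _ _ j) (sym (shared j i<n))

canonical-overlap : ∀ {n} k a c (x y : Vec Bool n) {L} →
                    (∀ i → k + i < n → stream x (k + i) ≡ stream y i) →
                    suc (k + k) ≤ L → CanonicalWithin (a , x) (c , y) L
canonical-overlap k a c x y shared ≤L =
  canonical-splice k (stream x) a c x y (window-splice-stream k x y shared) (≤-trans (cost≤ k _ a c) ≤L)

-- Required bits of the walk along x followed by y, where the last d bits of x are the first d bits of y.
concatBits : ∀ d {k} → Vec Bool (d + k) → Vec Bool (d + k) → ℕ → Bool
concatBits d x y i = stream x i xor stream y (d + i)

canonical-concat : ∀ d k a c (x y : Vec Bool (d + k)) {L} →
                   (∀ i → i < d → stream x (k + i) ≡ stream y i) →
                   cost k (concatBits d x y) a c ≤ L → CanonicalWithin (a , x) (c , y) L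
canonical-concat d k a c x y shared ≤L =
  canonical-splice k (stream x) a c x y (window-splice-stream k x y shared′)
    (≤-trans (≤-reflexive (cost-cong k a c bits≡)) ≤L)
  where
  z = splice k (stream x) (stream y)
  shared′ : ∀ i → k + i < d + k → stream x (k + i) ≡ stream y i
  shared′ i lt = shared i (+-cancelˡ-< k i d (subst (k + i <_) (+-comm d k) lt))
  bits≡ : ∀ i → i < k → requiredBit (d + k) z i ≡ concatBits d x y i
  bits≡ i i<k = cong₂ _xor_ (splice-< k _ _ i i<k) (trans (cong z (index i d k)) (splice-+ k _ _ (d + i)))
    where index : ∀ i d k → i + (d + k) ≡ k + (d + i)
          index = solve-∀

concatViaBits : ∀ {n} → Vec Bool n → Bool → Vec Bool n → ℕ → Bool
concatViaBits x β y i = stream (x ∷ʳ β) i xor stream (β ∷ y) i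

-- The walk along x β y takes one arc more than the one along x y, but the inserted
-- bit β can break an alternating pattern of required bits.
canonical-concat-via : ∀ {n} a c β (x y : Vec Bool n) {L} → cost (suc n) (concatViaBits x β y) a c ≤ L →
                       CanonicalWithin (a , x) (c , y) L
canonical-concat-via {n} a c β x y ≤L =
  canonical-splice (suc n) (stream (x ∷ʳ β)) a c x y x≡
    (≤-trans (≤-reflexive (cost-cong (suc n) a c bits≡)) ≤L)
  where
  f = stream (x ∷ʳ β)
  g = stream y
  z = splice (suc n) f g
  x≡ : window z n ≡ x
  x≡ = trans (window-cong n λ i i<n → trans (splice-< (suc n) f g i (m<n⇒m<1+n i<n))
                                             (stream-∷ʳ-< x β i i<n))
             (window-stream x)
  bits≡ : ∀ i → i < suc n → requiredBit n z i ≡ concatViaBits x β y i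
  bits≡ zero    _     = cong₂ _xor_ (splice-< (suc n) f g 0 (s≤s z≤n))
                                    (trans (splice-< (suc n) f g n ≤-refl) (stream-∷ʳ-last x β))
  bits≡ (suc i) i<1+n = cong₂ _xor_ (splice-< (suc n) f g (suc i) i<1+n)
                                    (trans (cong (z ∘ suc) (+-comm i n)) (splice-+ (suc n) f g i))

concatViaBits-head : ∀ {n} (x : Vec Bool (suc n)) β y → concatViaBits x β y 0 ≡ stream x 0 xor β
concatViaBits-head (b ∷ x) β y = refl

concatViaBits-suc : ∀ {n} (x : Vec Bool n) β y i → suc i < n →
                    concatViaBits x β y (suc i) ≡ stream x (suc i) xor stream y i
concatViaBits-suc x β y i i<n = cong (_xor stream y i) (stream-∷ʳ-< x β (suc i) i<n)

concatViaBits-last : ∀ {n} (x : Vec Bool (suc n)) β y → concatViaBits x β y (suc n) ≡ β xor stream y n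
concatViaBits-last x β y = cong (_xor stream y _) (stream-∷ʳ-last x β)

constant-or-jump : ∀ k (f : ℕ → Bool) →
                   (∀ i → i ≤ k → f i ≡ f 0) ⊎ (∃[ i ] i < k × f (suc i) ≡ not (f i))
constant-or-jump zero    f = inj₁ (λ { zero _ → refl })
constant-or-jump (suc k) f with f 1 ≟ f 0
... | no f₁≢f₀ = inj₂ (0 , s≤s z≤n , ¬-not f₁≢f₀)
... | yes f₁≡f₀ with constant-or-jump k (f ∘ suc)
...   | inj₁ const = inj₁ λ { zero _ → refl ; (suc i) (s≤s i≤k) → trans (const i i≤k) f₁≡f₀ }
...   | inj₂ (i , i<k , jump) = inj₂ (suc i , s≤s i<k , jump)

module _ (n₂ : ℕ) (a c : Bool) (x y : Vec Bool (suc (suc n₂))) where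
  private
    n = suc (suc n₂)
    σ = not a

  module _ (alt : ∀ i → i < n → concatBits 0 x y i ≡ alternating σ i) (c≡ : c ≡ alternating σ n) where
    private
      y≡ : ∀ i → i < n → stream y i ≡ stream x i xor alternating σ i
      y≡ i i<n = trans (sym (xor-cancelˡ (stream x i) (stream y i))) (cong (stream x i xor_) (alt i i<n))

    -- With β = ¬x₀ the required bits become 1, σ, ¬σ, …, σ′, σ′ (the last one repeated).
    canonical-2n-constant : (∀ i → i ≤ suc n₂ → stream x i ≡ stream x 0) →
                            CanonicalWithin (a , x) (c , y) (2 * n)
    canonical-2n-constant const = canonical-concat-via a c β x y (≤-reflexive (begin
      cost (suc n) B a c                                     ≡⟨ cost-head n B a c B₀≡1 ⟩
      toggles a true + suc (cost n (B ∘ suc) true c)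
        ≡⟨ cong (λ t → toggles a true + suc t)
                (cost-alternating-repeat n₂ σ true (B ∘ suc) c alternates repeats c≡′) ⟩
      toggles a true + suc (toggles true σ + suc (suc (n₂ + n₂))) ≡⟨ toggles-via-true a _ ⟩
      suc (suc (suc (suc (n₂ + n₂))))                        ≡⟨ arithmetic n₂ ⟩
      2 * n                                                  ∎))
      where
      open ≡-Reasoning
      x₀ = stream x 0
      β = not x₀
      B = concatViaBits x β y
      B₀≡1 : B 0 ≡ true
      B₀≡1 = trans (concatViaBits-head x β y) (xor-inverseʳ x₀)
      alternates : ∀ j → j ≤ n₂ → B (suc j) ≡ alternating σ j
      alternates j j≤n₂ = begin
        B (suc j)                                 ≡⟨ concatViaBits-suc x β y j (s≤s (s≤s j≤n₂)) ⟩
        stream x (suc j) xor stream y j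
          ≡⟨ cong₂ _xor_ (const (suc j) (s≤s j≤n₂)) (y≡ j j<n) ⟩
        x₀ xor (stream x j xor alternating σ j)
          ≡⟨ cong (λ b → x₀ xor (b xor alternating σ j)) (const j (m≤n⇒m≤1+n j≤n₂)) ⟩
        x₀ xor (x₀ xor alternating σ j)           ≡⟨ xor-cancelˡ x₀ _ ⟩
        alternating σ j                           ∎
        where j<n = s≤s (m≤n⇒m≤1+n j≤n₂)
      repeats : B (suc (suc n₂)) ≡ alternating σ n₂
      repeats = begin
        B (suc (suc n₂))                                   ≡⟨ concatViaBits-last x β y ⟩
        β xor stream y (suc n₂)                            ≡⟨ cong (β xor_) (y≡ (suc n₂) ≤-refl) ⟩
        β xor (stream x (suc n₂) xor alternating σ (suc n₂))
          ≡⟨ cong (λ b → β xor (b xor alternating σ (suc n₂))) (const (suc n₂) ≤-refl) ⟩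
        β xor (x₀ xor alternating σ (suc n₂))              ≡⟨ not-xor-cancelˡ x₀ _ ⟩
        not (alternating σ (suc n₂))                       ≡⟨ not-alternating-suc σ n₂ ⟩
        alternating σ n₂                                   ∎
      c≡′ : c ≡ alternating σ n₂
      c≡′ = trans c≡ (alternating-suc-suc σ n₂)
      toggles-via-true : ∀ a s → toggles a true + suc (toggles true (not a) + s) ≡ suc (suc s)
      toggles-via-true false s = refl
      toggles-via-true true  s = refl
      arithmetic : ∀ n₂ → suc (suc (suc (suc (n₂ + n₂)))) ≡ 2 * suc (suc n₂)
      arithmetic = solve-∀

    -- With β = x₀ ⊕ a the first arc needs no toggle, and the jump of x at i splits the
    -- remaining required bits into two runs, neither of them fully alternating.
    canonical-2n-jump : ∀ i → i < suc n₂ → stream x (suc i) ≡ not (stream x i) →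
                        CanonicalWithin (a , x) (c , y) (2 * n)
    canonical-2n-jump i i<n₁ jump with r , 1+i+r≡n ← m≤n⇒∃[o]m+o≡n (m<n⇒m<1+n i<n₁) =
      canonical-concat-via a c β x y (begin
        cost (suc n) B a c                  ≡⟨ cost-head n B a c B₀≡a ⟩
        toggles a a + suc (cost n B′ a c)   ≡⟨ cong (_+ suc (cost n B′ a c)) (toggles-refl a) ⟩
        suc (cost n B′ a c)
          ≡⟨ cong (λ m → suc (cost m B′ a c)) (sym (trans (+-suc i r) 1+i+r≡n)) ⟩
        suc (cost (i + suc r) B′ a c)       ≤⟨ s≤s (cost-split i (suc r) B′ a t c) ⟩
        suc (cost i B′ a t + cost (suc r) (λ j → B′ (i + j)) t c)
          ≤⟨ s≤s (+-mono-≤ first-run second-run) ⟩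
        suc (i + i + suc (r + r))           ≡⟨ trans (arithmetic i r) (cong (2 *_) 1+i+r≡n) ⟩
        2 * n                               ∎)
      where
      open ≤-Reasoning
      arithmetic : ∀ i r → suc (i + i + suc (r + r)) ≡ 2 * (suc i + r)
      arithmetic = solve-∀
      x₀ = stream x 0
      β = x₀ xor a
      B = concatViaBits x β y
      B′ = B ∘ suc
      t = B′ i
      B₀≡a : B 0 ≡ a
      B₀≡a = trans (concatViaBits-head x β y) (xor-cancelˡ x₀ a)
      t≡ : t ≡ not (alternating σ i)
      t≡ = trans (concatViaBits-suc x β y i (s≤s i<n₁))
                 (trans (cong₂ _xor_ jump (y≡ i (m<n⇒m<1+n i<n₁))) (not-xor-cancelˡ (stream x i) _))
      first-run : cost i B′ a t ≤ i + i
      first-run with cost-dichotomy i B′ a t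
      ... | inj₁ ≤i+i = ≤i+i
      ... | inj₂ (_ , t≡alt) = contradiction t≡ (not-¬ t≡alt)
      second-run : cost (suc r) (λ j → B′ (i + j)) t c ≤ suc (r + r)
      second-run with cost-dichotomy r (λ j → B′ (i + suc j)) t c
      ... | inj₁ ≤r+r = begin
        cost (suc r) (λ j → B′ (i + j)) t c
          ≡⟨ cost-head r (λ j → B′ (i + j)) t c (cong B′ (+-identityʳ i)) ⟩
        toggles t t + suc (cost r _ t c)
          ≡⟨ cong (_+ suc (cost r (λ j → B′ (i + suc j)) t c)) (toggles-refl t) ⟩
        suc (cost r (λ j → B′ (i + suc j)) t c) ≤⟨ s≤s ≤r+r ⟩
        suc (r + r)                             ∎
      ... | inj₂ (_ , c≡alt) = contradiction c≡¬alt (not-¬ (trans c≡alt shift-alternation))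
        where
        shift-alternation : alternating (not t) r ≡ alternating σ (i + r)
        shift-alternation = trans (cong (λ b → alternating b r) (trans (cong not t≡) (not-involutive _)))
                                  (sym (alternating-+ σ i r))
        c≡¬alt : c ≡ not (alternating σ (i + r))
        c≡¬alt = trans c≡ (trans (cong (alternating σ) (sym 1+i+r≡n)) (alternating-suc σ (i + r)))

  canonical-2n : CanonicalWithin (a , x) (c , y) (2 * n)
  canonical-2n with cost-dichotomy n (concatBits 0 x y) a c
  ... | inj₁ ≤n+n = canonical-concat 0 n a c x y (λ _ ()) (≤-trans ≤n+n (≤-reflexive (sym (double n))))
  ... | inj₂ (alt , c≡) with constant-or-jump (suc n₂) (stream x)
  ...   | inj₁ const            = canonical-2n-constant alt c≡ const
  ...   | inj₂ (i , i<n₁ , jump) = canonical-2n-jump alt c≡ i i<n₁ jump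

module _ (n₂ : ℕ) where
  private
    n = suc (suc n₂)
    0ⁿ = replicate n false

  canonical-from-1|0ⁿ : ∀ c y → CanonicalWithin (true , 0ⁿ) (c , y) (2 * n ∸ 1)
  canonical-from-1|0ⁿ c y@(false ∷ _) =
    canonical-concat 1 (suc n₂) true c 0ⁿ y
      (λ { zero _ → stream-replicate-false n (suc n₂ + 0) ; (suc _) (s≤s ()) })
      (≤-trans (cost≤ (suc n₂) (concatBits 1 0ⁿ y) true c) (≤-reflexive (sym (2*suc∸1 (suc n₂)))))
  canonical-from-1|0ⁿ c y@(true ∷ y′) with cost-dichotomy (suc n₂) (concatBits 0 0ⁿ y ∘ suc) true c
  ... | inj₁ ≤2n₂ =
    canonical-concat 0 n true c 0ⁿ y (λ _ ())
      (≤-trans (s≤s ≤2n₂) (≤-reflexive (sym (2*suc∸1 (suc n₂)))))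
  ... | inj₂ (alt , c≡) = canonical-concat-via true c true 0ⁿ y (≤-reflexive (begin
    suc (cost n (B ∘ suc) true c)
      ≡⟨ cong suc (cost-alternating-repeat n₂ true true (B ∘ suc) c alternates repeats
                      (trans c≡ (alternating-suc-suc true n₂))) ⟩
    suc (suc (suc (n₂ + n₂)))  ≡⟨ cong (suc ∘ suc) (sym (+-suc n₂ n₂)) ⟩
    suc (suc n₂ + suc n₂)      ≡⟨ sym (2*suc∸1 (suc n₂)) ⟩
    2 * n ∸ 1                  ∎))
    where
    open ≡-Reasoning
    B = concatViaBits 0ⁿ true y
    y≡ : ∀ j → j < n → stream y j ≡ alternating true j
    y≡ zero    _  = refl
    y≡ (suc j) lt = trans (cong (_xor stream y′ j) (sym (stream-replicate-false n (suc j)))) (alt j (≤-pred lt))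
    alternates : ∀ j → j ≤ n₂ → B (suc j) ≡ alternating true j
    alternates j j≤n₂ = trans (concatViaBits-suc 0ⁿ true y j (s≤s (s≤s j≤n₂)))
                              (trans (cong (_xor stream y j) (stream-replicate-false n (suc j)))
                                     (y≡ j (s≤s (m≤n⇒m≤1+n j≤n₂))))
    repeats : B (suc (suc n₂)) ≡ alternating true n₂
    repeats = trans (concatViaBits-last 0ⁿ true y)
                    (trans (cong not (y≡ (suc n₂) ≤-refl)) (not-alternating-suc true n₂))

all-false-or-first-true : ∀ n (f : ℕ → Bool) →
  (∀ i → i < n → f i ≡ false) ⊎ (∃[ p ] p < n × (∀ i → i < p → f i ≡ false) × f p ≡ true)
all-false-or-first-true zero    f = inj₁ (λ _ ())
all-false-or-first-true (suc n) f with f 0 in f₀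
... | true  = inj₂ (0 , s≤s z≤n , (λ _ ()) , f₀)
... | false with all-false-or-first-true n (f ∘ suc)
...   | inj₁ all-false = inj₁ λ { zero _ → f₀ ; (suc i) (s≤s i<n) → all-false i i<n }
...   | inj₂ (p , p<n , before , fₚ) =
  inj₂ (suc p , s≤s p<n , (λ { zero _ → f₀ ; (suc i) (s≤s i<p) → before i i<p }) , fₚ)

cost-zeros-then-one : ∀ k c →
                      cost (suc k) (stream (replicate k false ∷ʳ true)) false c ≡ suc (k + suc (toggles true c))
cost-zeros-then-one zero    c = refl
cost-zeros-then-one (suc k) c = cong suc (cost-zeros-then-one k c)

module _ (m₃ : ℕ) where
  private
    m = suc m₃
    n = suc m
    x = replicate m false ∷ʳ true
    x≡0 : ∀ i → i < m → stream x i ≡ false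
    x≡0 = stream-zeros-∷ʳ-< m true
    x≡1 : stream x m ≡ true
    x≡1 = stream-∷ʳ-last (replicate m false) true

  canonical-from-1|0ᵐ1-to-1∷ : ∀ c y′ → CanonicalWithin (true , x) (c , true ∷ y′) (2 * n ∸ 2)
  canonical-from-1|0ᵐ1-to-1∷ c y′ with cost-dichotomy m (stream y′) true c
  ... | inj₁ ≤m+m = canonical-concat 1 m true c x y shared (begin
    cost m (concatBits 1 x y) true c ≡⟨ cost-cong m true c bits≡ ⟩
    cost m (stream y′) true c        ≤⟨ ≤m+m ⟩
    m + m                            ≡⟨ sym (2*suc∸2 m) ⟩
    2 * n ∸ 2                        ∎)
    where
    open ≤-Reasoning
    y = true ∷ y′
    shared : ∀ i → i < 1 → stream x (m + i) ≡ stream y i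
    shared zero    _           = trans (cong (stream x) (+-identityʳ m)) x≡1
    shared (suc i) (s≤s ())
    bits≡ : ∀ i → i < m → concatBits 1 x y i ≡ stream y′ i
    bits≡ i i<m = cong (_xor stream y′ i) (x≡0 i i<m)
  ... | inj₂ (alt , c≡) = canonical-concat 0 n true c x y (λ _ ()) (≤-reflexive (begin
    cost n B true c
      ≡⟨ cost-alternating-repeat m₃ true true B c alternates repeats c≡′ ⟩
    toggles true true + suc (suc (m₃ + m₃)) ≡⟨ cong suc (sym (+-suc m₃ m₃)) ⟩
    m + m                                   ≡⟨ sym (2*suc∸2 m) ⟩
    2 * n ∸ 2                               ∎))
    where
    open ≡-Reasoning
    y = true ∷ y′
    B = concatBits 0 x y
    y≡ : ∀ i → i < n → stream y i ≡ alternating true i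
    y≡ zero    _         = refl
    y≡ (suc i) (s≤s i<m) = alt i i<m
    alternates : ∀ i → i ≤ m₃ → B i ≡ alternating true i
    alternates i i≤m₃ = trans (cong (_xor stream y i) (x≡0 i (s≤s i≤m₃)))
                              (y≡ i (s≤s (m≤n⇒m≤1+n i≤m₃)))
    repeats : B m ≡ alternating true m₃
    repeats = trans (cong₂ _xor_ x≡1 (y≡ m ≤-refl)) (not-alternating-suc true m₃)
    c≡′ : c ≡ alternating true m₃
    c≡′ = trans c≡ (alternating-suc-suc true m₃)

  canonical-from-1|0ᵐ1-to-0ⁿ : ∀ c y {L} → (∀ i → i < n → stream y i ≡ false) → 5 + m₃ ≤ L →
                               CanonicalWithin (true , x) (c , y) L
  canonical-from-1|0ᵐ1-to-0ⁿ c y y≡0 ≤L = canonical-concat 0 n true c x y (λ _ ()) (begin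
    cost n (concatBits 0 x y) true c     ≡⟨ cost-cong n true c bits≡ ⟩
    cost n (stream x) true c             ≡⟨ cong (2 +_) (cost-zeros-then-one m₃ c) ⟩
    2 + suc (m₃ + suc (toggles true c))  ≤⟨ +-monoʳ-≤ 3 (+-monoʳ-≤ m₃ (s≤s (toggles≤1 true c))) ⟩
    3 + (m₃ + 2)                         ≡⟨ cong (3 +_) (+-comm m₃ 2) ⟩
    5 + m₃                               ≤⟨ ≤L ⟩
    _                                    ∎)
    where
    open ≤-Reasoning
    bits≡ : ∀ i → i < n → concatBits 0 x y i ≡ stream x i
    bits≡ i i<n = trans (cong (stream x i xor_) (y≡0 i i<n)) (xor-identityʳ _)

  canonical-from-1|0ᵐ1-to-0^q1∷ : ∀ c y q k {L} → q + k ≡ m →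
                                  (∀ i → i < q → stream y i ≡ false) → stream y q ≡ true →
                                  suc (k + k) ≤ L → CanonicalWithin (true , x) (c , y) L
  canonical-from-1|0ᵐ1-to-0^q1∷ c y q k q+k≡m y≡0 y≡1 = canonical-overlap k true c x y shared
    where
    k+q≡m : k + q ≡ m
    k+q≡m = trans (+-comm k q) q+k≡m
    shared : ∀ i → k + i < n → stream x (k + i) ≡ stream y i
    shared i k+i<n with <-cmp i q
    ... | tri< i<q _ _  = trans (x≡0 (k + i) (<-≤-trans (+-monoʳ-< k i<q) (≤-reflexive k+q≡m)))
                                (sym (y≡0 i i<q))
    ... | tri≈ _ refl _ = trans (cong (stream x) k+q≡m) (trans x≡1 (sym y≡1))
    ... | tri> _ _ q<i  = contradiction (≤-pred k+i<n)
                                        (<⇒≱ (≤-<-trans (≤-reflexive (sym k+q≡m)) (+-monoʳ-< k q<i)))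

canonical-from-1|0ᵐ1 : ∀ m₄ c y →
  CanonicalWithin {5 + m₄} (true , replicate (4 + m₄) false ∷ʳ true) (c , y) (2 * (5 + m₄) ∸ 2)
canonical-from-1|0ᵐ1 m₄ c (true ∷ y′) = canonical-from-1|0ᵐ1-to-1∷ (3 + m₄) c y′
canonical-from-1|0ᵐ1 m₄ c (false ∷ y′) with all-false-or-first-true (4 + m₄) (stream y′)
... | inj₁ y′≡0 =
  canonical-from-1|0ᵐ1-to-0ⁿ (3 + m₄) c (false ∷ y′)
    (λ { zero _ → refl ; (suc i) (s≤s i<m) → y′≡0 i i<m })
    (≤-trans (m≤m+n (8 + m₄) m₄) (≤-reflexive (trans (arithmetic m₄) (sym (2*suc∸2 (4 + m₄))))))
  where arithmetic : ∀ m₄ → 8 + m₄ + m₄ ≡ (4 + m₄) + (4 + m₄)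
        arithmetic = solve-∀
... | inj₂ (p , p<m , y′≡0 , y′ₚ≡1) with k , 1+p+k≡m ← m≤n⇒∃[o]m+o≡n p<m =
  canonical-from-1|0ᵐ1-to-0^q1∷ (3 + m₄) c (false ∷ y′) (suc p) k 1+p+k≡m
    (λ { zero _ → refl ; (suc i) (s≤s i<p) → y′≡0 i i<p }) y′ₚ≡1 (begin
      suc (k + k)      ≤⟨ s≤s (+-monoʳ-≤ k (n≤1+n k)) ⟩
      suc k + suc k    ≤⟨ +-mono-≤ 1+k≤m 1+k≤m ⟩
      m + m            ≡⟨ sym (2*suc∸2 m) ⟩
      2 * suc m ∸ 2    ∎)
  where
  open ≤-Reasoning
  m = 4 + m₄
  1+k≤m : suc k ≤ m
  1+k≤m = ≤-trans (s≤s (m≤n+m k p)) (≤-reflexive 1+p+k≡m)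

-- Distances and eccentricities

least-witness : ∀ {P : ℕ → Set} → (∀ k → Dec (P k)) → ∀ {L} → P L →
                ∃[ d ] (P d × (∀ k → P k → d ≤ k)) × d ≤ L
least-witness {P} P? {L} = search 0 L refl (λ _ ())
  where
  search : ∀ m r → m + r ≡ L → (∀ k → k < m → ¬ P k) → P L →
           ∃[ d ] (P d × (∀ k → P k → d ≤ k)) × d ≤ L
  search m r m+r≡L none-below p with P? m
  ... | yes pm =
    m , (pm , λ k pk → ≮⇒≥ (λ k<m → none-below k k<m pk)) , subst (m ≤_) m+r≡L (m≤m+n m r)
  search m zero    m+r≡L none-below p | no ¬pm =
    contradiction (subst P (sym (trans (sym (+-identityʳ m)) m+r≡L)) p) ¬pm
  search m (suc r) m+r≡L none-below p | no ¬pm =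
    search (suc m) r (trans (sym (+-suc m r)) m+r≡L) none-below′ p
    where
    none-below′ : ∀ k → k < suc m → ¬ P k
    none-below′ k k<1+m with m≤n⇒m<n∨m≡n (≤-pred k<1+m)
    ... | inj₁ k<m  = none-below k k<m
    ... | inj₂ refl = ¬pm

walk? : ∀ {n} k (u v : V n) → Dec (Walk u v k)
walk? zero u v with Product.≡-dec _≟_ (Vec.≡-dec _≟_) u v
... | yes refl = yes here
... | no u≢v   = no λ { here → u≢v refl }
walk? (suc k) (a , x) v with walk? k (not a , x) v | walk? k (a , shiftArc a x) v
... | yes w | _     = yes (step (edge a x) w)
... | no _  | yes w = yes (step (arc a x) w)
... | no ¬e | no ¬a = no λ { (step (edge _ _) w) → ¬e w ; (step (arc _ _) w) → ¬a w }

distance : ∀ {n} {u v : V n} {L} → Walk u v L → ∃[ d ] IsDist u v d × d ≤ L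
distance {u = u} {v} = least-witness (λ k → walk? k u v)

ecc-intro : ∀ {n} (u t : V n) e → (∀ v → ReachableWithin u v e) → (∀ L → Walk u t L → e ≤ L) →
            Ecc u e
ecc-intro u t e reach far = within , t , far-dist
  where
  within : ∀ v → ∃[ d ] IsDist u v d × d ≤ e
  within v with L , w , L≤e ← reach v with d , dist , d≤L ← distance w = d , dist , ≤-trans d≤L L≤e
  far-dist : IsDist u t e
  far-dist with L , w , L≤e ← reach t = subst (Walk u t) (≤-antisym L≤e (far L w)) w , far

ecc≤ : ∀ {n} {u : V n} {e L} → Ecc u e → (∀ v → ReachableWithin u v L) → e ≤ L
ecc≤ (_ , v , _ , shortest) reach with L , w , L≤ ← reach v = ≤-trans (shortest L w) L≤

complement : ∀ {n} → V n → V n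
complement (a , x) = a , map not x

complement-involutive : ∀ {n} (u : V n) → complement (complement u) ≡ u
complement-involutive (a , x) =
  cong (a ,_) (trans (sym (map-∘ not not x)) (trans (map-cong not-involutive x) (map-id x)))

shiftArc-complement : ∀ {n} a (x : Vec Bool n) → shiftArc a (map not x) ≡ map not (shiftArc a x)
shiftArc-complement a []      = refl
shiftArc-complement a (b ∷ x) =
  trans (cong (map not x ∷ʳ_) (sym (not-distribˡ-xor b a))) (sym (map-∷ʳ not (b xor a) x))

walk-complement : ∀ {n} {u v : V n} {k} → Walk u v k → Walk (complement u) (complement v) k
walk-complement here                 = here
walk-complement (step (edge a x) w) = step (edge a (map not x)) (walk-complement w)
walk-complement (step (arc a x) w)  =
  step (subst (λ y → Step (a , map not x) (a , y)) (shiftArc-complement a x) (arc a (map not x)))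
       (walk-complement w)

ecc-complement : ∀ {n} {u : V n} {e} → Ecc u e → Ecc (complement u) e
ecc-complement {u = u} {e} (within , t , w , shortest) = within′ , complement t , walk-complement w , shortest′
  where
  from-complement : ∀ {v k} → Walk (complement u) v k → Walk u (complement v) k
  from-complement {v} {k} w =
    subst (λ u′ → Walk u′ (complement v) k) (complement-involutive u) (walk-complement w)
  shortest′ : ∀ k → Walk (complement u) (complement t) k → e ≤ k
  shortest′ k w = shortest k (subst (λ v → Walk u v k) (complement-involutive t) (from-complement w))
  within′ : ∀ v → ∃[ d ] IsDist (complement u) v d × d ≤ e
  within′ v with d , (w , d-shortest) , d≤e ← within (complement v) =
    d , (subst (λ v′ → Walk (complement u) v′ d) (complement-involutive v) (walk-complement w) ,
         λ k w′ → d-shortest k (from-complement w′)) , d≤e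

far : ∀ n → V n
far n = false , window (alternating true) n

module _ (n₂ : ℕ) where
  private
    n = suc (suc n₂)
    0ⁿ = replicate n false
    zeros : ∀ i → i < n → stream 0ⁿ i ≡ false
    zeros i _ = stream-replicate-false n i

  ecc-0|0ⁿ : Ecc (false , 0ⁿ) (2 * n)
  ecc-0|0ⁿ = ecc-intro _ (far n) (2 * n) (λ (c , y) → canonical⇒reachable (canonical-2n n₂ false c 0ⁿ y))
    λ L w → subst (_≤ L) (sym (double n))
                  (m+n≤o⇒m≤o∸n (n + n) (walk-to-alternating-lowerBound 0 n false 0ⁿ zeros w))

  ecc-1|0ⁿ : Ecc (true , 0ⁿ) (2 * n ∸ 1)
  ecc-1|0ⁿ = ecc-intro _ (far n) (2 * n ∸ 1)
               (λ (c , y) → canonical⇒reachable (canonical-from-1|0ⁿ n₂ c y))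
    λ L w → ∸-monoˡ-≤ 1 (subst (_≤ suc L) (trans (+-identityʳ (n + n)) (sym (double n)))
                                 (walk-to-alternating-lowerBound 0 n true 0ⁿ zeros w))

  ecc≤2n : ∀ (u : V n) e → Ecc u e → e ≤ 2 * n
  ecc≤2n (a , x) e ecc = ecc≤ ecc (λ (c , y) → canonical⇒reachable (canonical-2n n₂ a c x y))

  ecc-a|1ⁿ : ∀ {a e} → Ecc (a , 0ⁿ) e → Ecc (a , replicate n true) e
  ecc-a|1ⁿ {a} {e} ecc = subst (λ x → Ecc (a , x) e) (map-replicate not false n) (ecc-complement ecc)

module _ (m₄ : ℕ) where
  private
    m = 4 + m₄
    n = suc m
    x = replicate m false ∷ʳ true

  ecc-1|0ᵐ1 : Ecc (true , x) (2 * n ∸ 2)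
  ecc-1|0ᵐ1 = ecc-intro _ (far n) (2 * n ∸ 2)
                (λ (c , y) → canonical⇒reachable (canonical-from-1|0ᵐ1 m₄ c y))
    λ L w → subst (_≤ L) (sym (2*suc∸2 m))
                  (m+n≤o⇒m≤o∸n (m + m)
                    (walk-to-alternating-lowerBound 1 m true x (stream-zeros-∷ʳ-< m true) w))

  ecc-1|1ᵐ0 : Ecc (true , replicate m true ∷ʳ false) (2 * n ∸ 2)
  ecc-1|1ᵐ0 = subst (λ x → Ecc (true , x) (2 * n ∸ 2))
                    (trans (map-∷ʳ not true (replicate m false)) (cong (_∷ʳ false) (map-replicate not false m)))
                    (ecc-complement ecc-1|0ᵐ1)

mainTheorem4 : (∀ (n : ℕ) → 2 ≤ n →
                 (Ecc {n} (false , replicate n false) (2 * n)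
                  × Ecc {n} (false , replicate n true) (2 * n)
                  × (∀ (u : V n) (e : ℕ) → Ecc u e → e ≤ 2 * n))
                 × (Ecc {n} (true , replicate n false) (2 * n ∸ 1)
                  × Ecc {n} (true , replicate n true) (2 * n ∸ 1)))
              × (∀ (m : ℕ) → 5 ≤ suc m →
                 Ecc {suc m} (true , (replicate m false ∷ʳ true)) (2 * suc m ∸ 2)
                 × Ecc {suc m} (true , (replicate m true ∷ʳ false)) (2 * suc m ∸ 2))
mainTheorem4 =
  (λ { (suc (suc n₂)) (s≤s (s≤s _)) →
         (ecc-0|0ⁿ n₂ , ecc-a|1ⁿ n₂ (ecc-0|0ⁿ n₂) , ecc≤2n n₂) ,
         (ecc-1|0ⁿ n₂ , ecc-a|1ⁿ n₂ (ecc-1|0ⁿ n₂)) }) ,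
  (λ { (suc (suc (suc (suc m₄)))) (s≤s (s≤s (s≤s (s≤s (s≤s _))))) →
         ecc-1|0ᵐ1 m₄ , ecc-1|1ᵐ0 m₄ })
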